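{- Let $Y$ and $Y'$ be nondegenerate Young graphs that are isomorphic as Young graphs via an isomorphism $\phi$. Then $\phi([[0,0]])=[[0,0]]$ and $\phi([0,0])=[0,0]$.
   Context: For integers $2\le k<g$, the labeled directed graph $H(g,k)$ has a distinguished starting node $[[0,0]]$ and other nodes labeled by pairs $[R,r]$ of integers with $0\le R,r\le k-1$ (the node $[0,0]$ is distinct from the starting node). For a node $[P,p]$ (the starting node treated as $[0,0]$ here) there is an edge labeled $(A,a)$ from $[P,p]$ to $[R,r]$ whenever $0\le A,a\le g-1$ are integers, $0\le R,r\le k-1$, $ka+p=A+rg$ and $kA+R=a+Pg$; edges leaving the starting node additionally require $A\ne0\ne a$; no edge enters the starting node. $H(g,k)$ consists of the starting node and all nodes reachable from it. An even pivot node is a node $[a,a]$; an odd pivot node is a node $[r,s]$ with an edge to $[s,r]$; the starting node is not a pivot node. The Young graph $Y(g,k)$ is obtained from $H(g,k)$ by deleting every node that is not a pivot node and from which no pivot node is reachable, with incident edges; a Young graph is any $Y(g,k)$, and it is nondegenerate if $H(g,k)$ contains a pivot node. Two Young graphs are isomorphic as Young graphs via $\phi$ if $\phi$ is a bijection of node sets that is an isomorphism of the underlying unlabeled directed graphs and $x$ is an even (resp. odd) pivot node iff $\phi(x)$ is. -}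

module Defs where

open import Data.Nat using (ℕ; _+_; _*_; _<_; _≤_)
open import Data.Product using (Σ; ∃; ∃-syntax; _×_; _,_; proj₁)
open import Data.Sum using (_⊎_)
open import Data.Empty using (⊥)
open import Relation.Nullary using (¬_)
open import Relation.Binary.PropositionalEquality using (_≡_)
open import Relation.Binary.Construct.Closure.ReflexiveTransitive using (Star)

-- Nodes of H(g,k): the distinguished starting node [[0,0]], and nodes [R,r].
data Node : Set where
  start : Node
  pt    : ℕ → ℕ → Node

-- Coordinates of a node; the starting node is treated as [0,0].
fstN : Node → ℕ
fstN start    = 0
fstN (pt P p) = P

sndN : Node → ℕ
sndN start    = 0
sndN (pt P p) = p

data LEdge (g k : ℕ) : Node → ℕ → ℕ → Node → Set where
  fromStart : ∀ {A a R r} → A < g → a < g → R < k → r < k →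
              ¬ (A ≡ 0) → ¬ (a ≡ 0) →
              k * a + 0 ≡ A + r * g → k * A + R ≡ a + 0 * g →
              LEdge g k start A a (pt R r)
  fromPt    : ∀ {P p A a R r} → P < k → p < k →
              A < g → a < g → R < k → r < k →
              k * a + p ≡ A + r * g → k * A + R ≡ a + P * g →
              LEdge g k (pt P p) A a (pt R r)

Edge : ℕ → ℕ → Node → Node → Set
Edge g k x y = ∃[ A ] ∃[ a ] LEdge g k x A a y

Reach : ℕ → ℕ → Node → Node → Set
Reach g k = Star (Edge g k)

InH : ℕ → ℕ → Node → Set
InH g k x = Reach g k start x

EvenPivot : ℕ → ℕ → Node → Set
EvenPivot g k start    = ⊥
EvenPivot g k (pt R r) = InH g k (pt R r) × R ≡ r

OddPivot : ℕ → ℕ → Node → Set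
OddPivot g k start    = ⊥
OddPivot g k (pt r s) = InH g k (pt r s) × Edge g k (pt r s) (pt s r)

Pivot : ℕ → ℕ → Node → Set
Pivot g k x = EvenPivot g k x ⊎ OddPivot g k x

InY : ℕ → ℕ → Node → Set
InY g k x = InH g k x × ∃[ y ] (Reach g k x y × Pivot g k y)

YNode : ℕ → ℕ → Set
YNode g k = Σ Node (InY g k)

ValidParams : ℕ → ℕ → Set
ValidParams g k = 2 ≤ k × k < g

Nondegenerate : ℕ → ℕ → Set
Nondegenerate g k = ∃[ x ] Pivot g k x

-- An isomorphism of Young graphs Y(g,k) → Y(g',k'), as a map on the
-- subtype of nodes; node identity is equality of the underlying Node.
record YoungIso (g k g' k' : ℕ) (φ : YNode g k → YNode g' k') : Set where
  field
    wellDefined : ∀ x y → proj₁ x ≡ proj₁ y → proj₁ (φ x) ≡ proj₁ (φ y)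
    injective   : ∀ x y → proj₁ (φ x) ≡ proj₁ (φ y) → proj₁ x ≡ proj₁ y
    surjective  : ∀ (y : YNode g' k') → Σ (YNode g k) λ x → proj₁ (φ x) ≡ proj₁ y
    edge⇒       : ∀ x y → Edge g k (proj₁ x) (proj₁ y) → Edge g' k' (proj₁ (φ x)) (proj₁ (φ y))
    edge⇐       : ∀ x y → Edge g' k' (proj₁ (φ x)) (proj₁ (φ y)) → Edge g k (proj₁ x) (proj₁ y)
    even⇒       : ∀ x → EvenPivot g k (proj₁ x) → EvenPivot g' k' (proj₁ (φ x))
    even⇐       : ∀ x → EvenPivot g' k' (proj₁ (φ x)) → EvenPivot g k (proj₁ x)
    odd⇒        : ∀ x → OddPivot g k (proj₁ x) → OddPivot g' k' (proj₁ (φ x))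
    odd⇐        : ∀ x → OddPivot g' k' (proj₁ (φ x)) → OddPivot g k (proj₁ x)

-- The starting node is recognised purely graph-theoretically: it is the only
-- node of a Young graph without a predecessor in the Young graph, because
-- every other node is reached from it by a path whose nodes all stay in
-- Y(g,k).  Isomorphisms preserve "having no predecessor", so they fix it.
--
-- The node [0,0] is then recognised as the unique even pivot node n such
-- that there is no edge [[0,0]] → n, but n shares a successor with [[0,0]]:
--   * [0,0] has these properties, since every edge leaving [[0,0]] also
--     leaves [0,0], nondegeneracy supplies one such edge, and the edge
--     equations rule out an edge [[0,0]] → [0,0];
--   * conversely, if [P,P] and [[0,0]] share a successor [R,r] via labels
--     (B,b) and (A,a), subtracting the edge equations shows that b ≤ a is
--     impossible when P ≥ 1, while for b = a + d the label (d, k d + P) is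
--     an edge [[0,0]] → [P,P]; so P = 0.
-- These properties are preserved by isomorphisms fixing [[0,0]].
module Submission where

open import Defs
open import Data.Nat
open import Data.Nat.Properties
open import Data.Nat.Tactic.RingSolver using (solve-∀)
open import Data.Product
open import Data.Sum using (_⊎_; inj₁; inj₂)
open import Data.Empty using (⊥; ⊥-elim)
open import Relation.Nullary using (¬_; yes; no)
open import Relation.Binary.PropositionalEquality
open import Relation.Binary.Construct.Closure.ReflexiveTransitive using (Star; ε; _◅_)

edgeEquations : ∀ {g k x A a y} → LEdge g k x A a y →
                (k * a + sndN x ≡ A + sndN y * g) × (k * A + fstN y ≡ a + fstN x * g)
edgeEquations (fromStart _ _ _ _ _ _ e₁ e₂) = e₁ , e₂
edgeEquations (fromPt _ _ _ _ _ _ e₁ e₂)    = e₁ , e₂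

-- Subtracting the equations of an edge [[0,0]] → [R,r] labelled (A,a) from
-- those of an edge [P,p] → [R,r] labelled (B,b) eliminates the target.
differenceEquations : ∀ k g P p a A b B R r →
  k * a + 0 ≡ A + r * g → k * A + R ≡ a + 0 * g →
  k * b + p ≡ B + r * g → k * B + R ≡ b + P * g →
  (k * b + p + A ≡ B + k * a) × (k * B + a ≡ b + P * g + k * A)
differenceEquations k g P p a A b B R r e₁ e₂ e₃ e₄ =
  +-cancelʳ-≡ (r * g) _ _ firstSum , +-cancelʳ-≡ R _ _ secondSum
  where
  open ≡-Reasoning
  firstSum : k * b + p + A + r * g ≡ B + k * a + r * g
  firstSum = begin
    k * b + p + A + r * g         ≡⟨ shuffle₁ k b p A r g ⟩
    (k * b + p) + (A + r * g)     ≡⟨ cong₂ _+_ e₃ (sym e₁) ⟩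
    (B + r * g) + (k * a + 0)     ≡⟨ shuffle₂ B r g k a ⟩
    B + k * a + r * g             ∎
    where
    shuffle₁ : ∀ k b p A r g → k * b + p + A + r * g ≡ (k * b + p) + (A + r * g)
    shuffle₁ = solve-∀
    shuffle₂ : ∀ B r g k a → (B + r * g) + (k * a + 0) ≡ B + k * a + r * g
    shuffle₂ = solve-∀
  secondSum : k * B + a + R ≡ b + P * g + k * A + R
  secondSum = begin
    k * B + a + R                 ≡⟨ shuffle₁ k B a R g ⟩
    (k * B + R) + (a + 0 * g)     ≡⟨ cong₂ _+_ e₄ (sym e₂) ⟩
    (b + P * g) + (k * A + R)     ≡⟨ shuffle₂ b P g k A R ⟩
    b + P * g + k * A + R         ∎
    where
    shuffle₁ : ∀ k B a R g → k * B + a + R ≡ (k * B + R) + (a + 0 * g)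
    shuffle₁ = solve-∀
    shuffle₂ : ∀ b P g k A R → (b + P * g) + (k * A + R) ≡ b + P * g + k * A + R
    shuffle₂ = solve-∀

-- If the label of the edge out of [P,P] is not longer, i.e. a = b + e,
-- the difference equations force k P + e = k² e + P g, impossible for P ≥ 1
-- since k P < P g and e ≤ k² e.
shorterLabelImpossible : ∀ k g P e A b B → 1 ≤ P → 1 ≤ k → k < g →
  k * b + P + A ≡ B + k * (b + e) → k * B + (b + e) ≡ b + P * g + k * A → ⊥
shorterLabelImpossible k g P e A b B 1≤P 1≤k k<g d₁ d₂ =
  <-irrefl balance (+-mono-≤-< e≤k²e kP<Pg)
  where
  open ≡-Reasoning
  firstReduced : P + A ≡ B + k * e
  firstReduced = +-cancelˡ-≡ (k * b) _ _ (begin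
    k * b + (P + A)         ≡⟨ +-assoc (k * b) P A ⟨
    k * b + P + A           ≡⟨ d₁ ⟩
    B + k * (b + e)         ≡⟨ expand B k b e ⟩
    k * b + (B + k * e)     ∎)
    where
    expand : ∀ B k b e → B + k * (b + e) ≡ k * b + (B + k * e)
    expand = solve-∀
  secondReduced : k * B + e ≡ P * g + k * A
  secondReduced = +-cancelˡ-≡ b _ _ (begin
    b + (k * B + e)         ≡⟨ +-comm b (k * B + e) ⟩
    k * B + e + b           ≡⟨ +-assoc (k * B) e b ⟩
    k * B + (e + b)         ≡⟨ cong (k * B +_) (+-comm e b) ⟩
    k * B + (b + e)         ≡⟨ d₂ ⟩
    b + P * g + k * A       ≡⟨ +-assoc b (P * g) (k * A) ⟩
    b + (P * g + k * A)     ∎)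
  balance : e + k * P ≡ k * k * e + P * g
  balance = +-cancelʳ-≡ (k * A + k * B) _ _ (begin
    e + k * P + (k * A + k * B)     ≡⟨ regroup₁ e k P A B ⟩
    k * (P + A) + (k * B + e)       ≡⟨ cong₂ (λ u v → k * u + v) firstReduced secondReduced ⟩
    k * (B + k * e) + (P * g + k * A) ≡⟨ regroup₂ k B e P g A ⟩
    k * k * e + P * g + (k * A + k * B) ∎)
    where
    regroup₁ : ∀ e k P A B → e + k * P + (k * A + k * B) ≡ k * (P + A) + (k * B + e)
    regroup₁ = solve-∀
    regroup₂ : ∀ k B e P g A → k * (B + k * e) + (P * g + k * A) ≡ k * k * e + P * g + (k * A + k * B)
    regroup₂ = solve-∀
  e≤k²e : e ≤ k * k * e
  e≤k²e = subst (_≤ k * k * e) (*-identityˡ e) (*-monoˡ-≤ e (*-mono-≤ 1≤k 1≤k))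
  kP<Pg : k * P < P * g
  kP<Pg = subst (_< P * g) (*-comm P k) (*-monoʳ-< P {{>-nonZero 1≤P}} k<g)

-- If the label of the edge out of [P,p] is longer, b = a + d, then
-- B = A + (k d + p) and the pair (d, k d + p) satisfies the equations of
-- an edge [[0,0]] → [P,p].
longerLabelEquations : ∀ k g P p d A a B →
  k * (a + d) + p + A ≡ B + k * a → k * B + a ≡ (a + d) + P * g + k * A →
  (B ≡ A + (k * d + p)) × (k * (k * d + p) ≡ d + P * g)
longerLabelEquations k g P p d A a B d₁ d₂ = labelGap , startEquation
  where
  open ≡-Reasoning
  labelGap : B ≡ A + (k * d + p)
  labelGap = +-cancelʳ-≡ (k * a) _ _ (begin
    B + k * a               ≡⟨ d₁ ⟨
    k * (a + d) + p + A     ≡⟨ regroup k a d p A ⟩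
    A + (k * d + p) + k * a ∎)
    where
    regroup : ∀ k a d p A → k * (a + d) + p + A ≡ A + (k * d + p) + k * a
    regroup = solve-∀
  startEquation : k * (k * d + p) ≡ d + P * g
  startEquation = +-cancelˡ-≡ (k * A + a) _ _ (begin
    k * A + a + k * (k * d + p)   ≡⟨ regroup₁ k A a d p ⟩
    k * (A + (k * d + p)) + a     ≡⟨ cong (λ u → k * u + a) labelGap ⟨
    k * B + a                     ≡⟨ d₂ ⟩
    (a + d) + P * g + k * A       ≡⟨ regroup₂ a d P g k A ⟩
    k * A + a + (d + P * g)       ∎)
    where
    regroup₁ : ∀ k A a d p → k * A + a + k * (k * d + p) ≡ k * (A + (k * d + p)) + a
    regroup₁ = solve-∀
    regroup₂ : ∀ a d P g k A → (a + d) + P * g + k * A ≡ k * A + a + (d + P * g)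
    regroup₂ = solve-∀

<-scaled : ∀ k m → 2 ≤ k → ¬ m ≡ 0 → m < k * m
<-scaled k zero    _   m≢0 = ⊥-elim (m≢0 refl)
<-scaled k (suc m) 2≤k _   = subst (_< k * suc m) (*-identityˡ (suc m)) (*-monoˡ-< (suc m) 2≤k)

-- There is no edge [[0,0]] → [0,0]: its label would satisfy k a = A and
-- k A = a with A, a > 0, hence a < A < a.
noEdgeStartToOrigin : ∀ {g k} → 2 ≤ k → ¬ Edge g k start (pt 0 0)
noEdgeStartToOrigin {g} {k} 2≤k (A , a , fromStart _ _ _ _ A≢0 a≢0 e₁ e₂) =
  <-irrefl refl (<-trans (subst (a <_) ka≡A (<-scaled k a 2≤k a≢0))
                         (subst (A <_) kA≡a (<-scaled k A 2≤k A≢0)))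
  where
  ka≡A : k * a ≡ A
  ka≡A = trans (sym (+-identityʳ (k * a))) (trans e₁ (+-identityʳ A))
  kA≡a : k * A ≡ a
  kA≡a = trans (sym (+-identityʳ (k * A))) (trans e₂ (+-identityʳ a))

startEdge⇒originEdge : ∀ {g k z} → 0 < k → Edge g k start z → Edge g k (pt 0 0) z
startEdge⇒originEdge 0<k (A , a , fromStart A<g a<g R<k r<k _ _ e₁ e₂) =
  A , a , fromPt 0<k 0<k A<g a<g R<k r<k e₁ e₂

-- Key lemma: if [P,P] and [[0,0]] have a common successor and there is no
-- edge [[0,0]] → [P,P], then P = 0.  For P ≥ 1 compare the labels b (out of
-- [P,P]) and a (out of [[0,0]]): b ≤ a is impossible, and b > a yields an
-- edge [[0,0]] → [P,P] labelled (b ∸ a, k (b ∸ a) + P).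
commonSuccessor⇒origin : ∀ g k P z → ValidParams g k →
  Edge g k start z → Edge g k (pt P P) z → ¬ Edge g k start (pt P P) → P ≡ 0
commonSuccessor⇒origin g k zero z _ _ _ _ = refl
commonSuccessor⇒origin g k P@(suc n) (pt R r) (2≤k , k<g)
  (A , a , startEdge)
  (B , b , pivotEdge@(fromPt P<k _ B<g b<g _ _ _ _)) noStartEdge
  with edgeEquations startEdge | edgeEquations pivotEdge
... | e₁ , e₂ | e₃ , e₄
  with differenceEquations k g P P a A b B R r e₁ e₂ e₃ e₄ | b ≤? a
... | d₁ , d₂ | yes b≤a = ⊥-elim
  (shorterLabelImpossible k g P (a ∸ b) A b B (s≤s z≤n) (≤-trans (s≤s z≤n) 2≤k) k<g
    (subst (λ u → k * b + P + A ≡ B + k * u) a≡b+e d₁)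
    (subst (λ u → k * B + u ≡ b + P * g + k * A) a≡b+e d₂))
  where
  a≡b+e : a ≡ b + (a ∸ b)
  a≡b+e = sym (m+[n∸m]≡n b≤a)
... | d₁ , d₂ | no b≰a = ⊥-elim
  (noStartEdge (d , D , fromStart d<g D<g P<k P<k d≢0 (m+1+n≢0 (k * d))
                                   (trans (+-identityʳ (k * D)) startEquation)
                                   (sym (+-identityʳ D))))
  where
  a<b : a < b
  a<b = ≰⇒> b≰a
  d : ℕ
  d = b ∸ a
  b≡a+d : b ≡ a + d
  b≡a+d = sym (m+[n∸m]≡n (<⇒≤ a<b))
  d≢0 : ¬ d ≡ 0
  d≢0 = n>0⇒n≢0 (m<n⇒0<n∸m a<b)
  D : ℕ
  D = k * d + P
  gapAndEquation : (B ≡ A + D) × (k * D ≡ d + P * g)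
  gapAndEquation = longerLabelEquations k g P P d A a B
    (subst (λ u → k * u + P + A ≡ B + k * a) b≡a+d d₁)
    (subst (λ u → k * B + a ≡ u + P * g + k * A) b≡a+d d₂)
  startEquation : k * D ≡ d + P * g
  startEquation = proj₂ gapAndEquation
  labelGap : B ≡ A + D
  labelGap = proj₁ gapAndEquation
  d<g : d < g
  d<g = ≤-<-trans (m∸n≤m b a) b<g
  D<g : D < g
  D<g = ≤-<-trans (subst (D ≤_) (sym labelGap) (m≤n+m D A)) B<g

noEdgeIntoStart : ∀ {g k x} → ¬ Edge g k x start
noEdgeIntoStart (_ , _ , ())

lastStep : ∀ {g k u v} → Reach g k u v →
           u ≡ v ⊎ ∃[ w ] (Reach g k u w × Edge g k w v)
lastStep ε = inj₁ refl
lastStep (e ◅ p) with lastStep p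
... | inj₁ refl           = inj₂ (_ , ε , e)
... | inj₂ (w , q , e′)   = inj₂ (w , e ◅ q , e′)

-- Every node of Y(g,k) other than the starting node has a predecessor in
-- Y(g,k): the last edge of a path from [[0,0]]; its source reaches a pivot
-- through the node itself.
noPredecessorInY⇒start : ∀ g k n → InY g k n →
  (∀ w → InY g k w → ¬ Edge g k w n) → n ≡ start
noPredecessorInY⇒start g k start    _ _ = refl
noPredecessorInY⇒start g k (pt R r) (pathFromStart , pivot , toPivot , isPivot) noPred
  with lastStep pathFromStart
... | inj₂ (w , toW , e) = ⊥-elim (noPred w (toW , pivot , e ◅ toPivot , isPivot) e)

pivot⇒InH : ∀ g k n → Pivot g k n → InH g k n
pivot⇒InH g k (pt R r) (inj₁ (inH , _)) = inH
pivot⇒InH g k (pt R r) (inj₂ (inH , _)) = inH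

startInY : ∀ g k → Nondegenerate g k → InY g k start
startInY g k (n , isPivot) = ε , n , pivot⇒InH g k n isPivot , isPivot

-- In a nondegenerate Young graph some edge leaves the starting node inside
-- Y(g,k): the first edge of a path to a pivot node.
firstStepToPivot : ∀ g k → Nondegenerate g k → ∃[ z ] (Edge g k start z × InY g k z)
firstStepToPivot g k (n , isPivot) with pivot⇒InH g k n isPivot
firstStepToPivot g k (start , inj₁ ()) | ε
firstStepToPivot g k (start , inj₂ ()) | ε
... | e ◅ rest = _ , e , e ◅ ε , n , rest , isPivot

module _ {g k g′ k′ : ℕ} {φ : YNode g k → YNode g′ k′} (iso : YoungIso g k g′ k′ φ) where
  open YoungIso iso

  -- An isomorphism maps the starting node to the starting node, since it
  -- reflects predecessors and the starting node has none.
  isoFixesStart : (x : YNode g k) → proj₁ x ≡ start → proj₁ (φ x) ≡ start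
  isoFixesStart x x≡start = noPredecessorInY⇒start g′ k′ (proj₁ (φ x)) (proj₂ (φ x)) noPred
    where
    noPred : ∀ w → InY g′ k′ w → ¬ Edge g′ k′ w (proj₁ (φ x))
    noPred w inY e with surjective (w , inY)
    ... | x′ , φx′≡w = noEdgeIntoStart (subst (Edge g k (proj₁ x′)) x≡start
            (edge⇐ x′ x (subst (λ t → Edge g′ k′ t (proj₁ (φ x))) (sym φx′≡w) e)))

  startEdge⇒ : (s y : YNode g k) → proj₁ s ≡ start →
    Edge g k start (proj₁ y) → Edge g′ k′ start (proj₁ (φ y))
  startEdge⇒ s y s≡start e =
    subst (λ t → Edge g′ k′ t (proj₁ (φ y))) (isoFixesStart s s≡start)
      (edge⇒ s y (subst (λ t → Edge g k t (proj₁ y)) (sym s≡start) e))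

  startEdge⇐ : (s y : YNode g k) → proj₁ s ≡ start →
    Edge g′ k′ start (proj₁ (φ y)) → Edge g k start (proj₁ y)
  startEdge⇐ s y s≡start e =
    subst (λ t → Edge g k t (proj₁ y)) s≡start
      (edge⇐ s y (subst (λ t → Edge g′ k′ t (proj₁ (φ y))) (sym (isoFixesStart s s≡start)) e))

evenPivotCharacterisation : ∀ g k n z → ValidParams g k → EvenPivot g k n →
  Edge g k n z → Edge g k start z → ¬ Edge g k start n → n ≡ pt 0 0
evenPivotCharacterisation g k (pt P .P) z valid (_ , refl) pivotEdge startEdge noStartEdge =
  cong (λ t → pt t t) (commonSuccessor⇒origin g k P z valid startEdge pivotEdge noStartEdge)

theorem3 : (g k g' k' : ℕ) → ValidParams g k → ValidParams g' k' →
    Nondegenerate g k → Nondegenerate g' k' →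
    (φ : YNode g k → YNode g' k') → YoungIso g k g' k' φ →
    ((x : YNode g k) → proj₁ x ≡ start → proj₁ (φ x) ≡ start)
    × ((x : YNode g k) → proj₁ x ≡ pt 0 0 → proj₁ (φ x) ≡ pt 0 0)
theorem3 g k g' k' (2≤k , _) valid′ nondeg _ φ iso = isoFixesStart iso , fixesOrigin
  where
  open YoungIso iso
  s : YNode g k
  s = start , startInY g k nondeg
  firstStep : ∃[ z ] (Edge g k start z × InY g k z)
  firstStep = firstStepToPivot g k nondeg
  z : YNode g k
  z = proj₁ firstStep , proj₂ (proj₂ firstStep)
  fixesOrigin : (x : YNode g k) → proj₁ x ≡ pt 0 0 → proj₁ (φ x) ≡ pt 0 0
  fixesOrigin x@(.(pt 0 0) , inH , _) refl =
    evenPivotCharacterisation g' k' (proj₁ (φ x)) (proj₁ (φ z)) valid′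
      (even⇒ x (inH , refl))
      (edge⇒ x z (startEdge⇒originEdge (≤-trans (s≤s z≤n) 2≤k) (proj₁ (proj₂ firstStep))))
      (startEdge⇒ iso s z refl (proj₁ (proj₂ firstStep)))
      (λ e → noEdgeStartToOrigin 2≤k (startEdge⇐ iso s x refl e))
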